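{- Let $n\ge3$. Start from $\varphi_0=\textsf{AtMostOne}(x_1,\dots,x_n)$ and repeatedly apply the following heuristic BVA procedure to the current formula $\varphi$ until it stops: for each variable $v$ of $\varphi$ let $N(v)$ be the set of literals $\ell$ such that $(\overline{v}\lor\ell)\in\varphi$; choose a variable $v$ with $|N(v)|$ maximum (any such $v$); set $L=\{v\}$, $R=N(v)$, $Q=|L||R|-|L|-|R|$; then repeat: iterate over the variables $w\notin L$ in some order, computing $R_w=R\cap N(w)$ and $Q_w=(|L|+1)|R_w|-(|L|+1)-|R_w|$, and keep as candidate the first $w$ (in that order) whose $Q_w$ strictly exceeds the best value seen so far (initially $Q$); if no candidate exists, exit this loop; otherwise add the candidate $w$ to $L$ and set $R:=R_w$, $Q:=Q_w$. After the loop, if $Q>0$, perform the BVA step with $\mathcal{C}=\{(\overline{v}):v\in L\}$ and $\mathcal{D}=\{(\ell):\ell\in R\}$ (replacing the clauses $(\overline{v}\lor\ell)$, $v\in L,\ell\in R$, by $(\overline{v}\lor y)$, $v\in L$, and $(\overline{y}\lor\ell)$, $\ell\in R$, for a fresh variable $y$) and continue; if $Q\le0$, stop. Then, for every possible resolution of the choices (the choice of $v$ and the iteration orders), the final formula has exactly $3n-6$ clauses.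
   Context: A literal is a variable $x$ or its negation $\overline{x}$; a clause is a set of non-complementary literals; a formula is a set of clauses, and its size is its number of clauses. $\textsf{AtMostOne}(x_1,\dots,x_n):=\bigwedge_{1\le i<j\le n}(\overline{x_i}\lor\overline{x_j})$. A BVA step on $\varphi$: given sets $\mathcal{C},\mathcal{D}$ of nonempty clauses with $\{C\cup D: C\in\mathcal{C},D\in\mathcal{D}\}\subseteq\varphi$ and a fresh variable $y$, replace these clauses $C\cup D$ by the clauses $C\cup\{y\}$ ($C\in\mathcal{C}$) and $\{\overline{y}\}\cup D$ ($D\in\mathcal{D}$). -}

module Defs where

open import Data.Nat using (ℕ; _≤_; _<_)
open import Data.Integer as ℤ using (ℤ; +_)
open import Data.List using (List; []; _∷_; _++_; map; length; [_])
open import Data.List.Membership.Propositional using (_∈_; _∉_)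
open import Data.List.Relation.Unary.Any using (Any)
open import Data.List.Relation.Unary.AllPairs using (AllPairs)
open import Data.List.Relation.Unary.Unique.Propositional using (Unique)
open import Data.Maybe using (Maybe; just; nothing)
open import Data.Product using (Σ; ∃; ∃-syntax; _×_; _,_)
open import Data.Sum using (_⊎_)
open import Function.Bundles using (_⇔_)
open import Relation.Nullary using (¬_)
open import Relation.Binary.PropositionalEquality using (_≡_)

-- Variables are natural numbers (x_i is the variable i).
-- A clause is a finite set of literals, represented by a list and
-- compared up to having the same elements (_≋_).
-- A formula is a finite set of clauses, represented by a list of
-- clauses containing no two equal (≋) clauses (see Distinct); its size
-- is then the length of the list.

data Lit : Set where
  pos : ℕ → Lit
  neg : ℕ → Lit

Clause : Set
Clause = List Lit

Formula : Set
Formula = List Clause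

_≋_ : Clause → Clause → Set
C ≋ D = ∀ ℓ → (ℓ ∈ C) ⇔ (ℓ ∈ D)

_∈F_ : Clause → Formula → Set
C ∈F φ = Any (C ≋_) φ

Distinct : Formula → Set
Distinct φ = AllPairs (λ C D → ¬ (C ≋ D)) φ

IsVar : Formula → ℕ → Set
IsVar φ x = ∃[ C ] (C ∈ φ × (pos x ∈ C ⊎ neg x ∈ C))

⟨_∨_⟩ : Lit → Lit → Clause
⟨ a ∨ b ⟩ = a ∷ b ∷ []

IsAMOClause : ℕ → Clause → Set
IsAMOClause n C = ∃[ i ] ∃[ j ] (1 ≤ i × i < j × j ≤ n × C ≋ ⟨ neg i ∨ neg j ⟩)

IsReplaced : List Clause → List Clause → Clause → Set
IsReplaced 𝒞 𝒟 E = ∃[ C ] ∃[ D ] (C ∈ 𝒞 × D ∈ 𝒟 × E ≋ (C ++ D))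

record BVAStep (φ : Formula) (𝒞 𝒟 : List Clause) (y : ℕ) (φ' : Formula) : Set where
  field
    𝒞-nonempty : ∀ C → C ∈ 𝒞 → ¬ (C ≡ [])
    𝒟-nonempty : ∀ D → D ∈ 𝒟 → ¬ (D ≡ [])
    present    : ∀ C D → C ∈ 𝒞 → D ∈ 𝒟 → (C ++ D) ∈F φ
    fresh      : ¬ IsVar φ y
    distinct   : Distinct φ'
    result     : ∀ E → (E ∈F φ') ⇔
                   (  (E ∈F φ × ¬ IsReplaced 𝒞 𝒟 E)
                   ⊎ (∃[ C ] (C ∈ 𝒞 × E ≋ (C ++ [ pos y ])))
                   ⊎ (∃[ D ] (D ∈ 𝒟 × E ≋ (neg y ∷ D))))

IsN : Formula → ℕ → List Lit → Set
IsN φ v R = Unique R × (∀ ℓ → (ℓ ∈ R) ⇔ (⟨ neg v ∨ ℓ ⟩ ∈F φ))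

IsRw : Formula → ℕ → List Lit → List Lit → Set
IsRw φ w R Rw = Unique Rw × (∀ ℓ → (ℓ ∈ Rw) ⇔ (ℓ ∈ R × ⟨ neg w ∨ ℓ ⟩ ∈F φ))

Qval : ℕ → ℕ → ℤ
Qval l r = (+ (l Data.Nat.* r) ℤ.- + l) ℤ.- + r
  where import Data.Nat

IsOrder : Formula → List ℕ → List ℕ → Set
IsOrder φ L ws = Unique ws × (∀ w → (w ∈ ws) ⇔ (IsVar φ w × w ∉ L))

-- Scan φ l R best cand ws res : iterating over ws with current best value
-- `best` and current candidate `cand` (w, R_w, Q_w), where l = |L|,
-- ends with candidate `res`.
Cand : Set
Cand = Maybe (ℕ × List Lit × ℤ)

data Scan (φ : Formula) (l : ℕ) (R : List Lit) : ℤ → Cand → List ℕ → Cand → Set where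
  done    : ∀ {best c} → Scan φ l R best c [] c
  improve : ∀ {best c w ws Rw res} → IsRw φ w R Rw →
            best ℤ.< Qval (Data.Nat.suc l) (length Rw) →
            Scan φ l R (Qval (Data.Nat.suc l) (length Rw))
                 (just (w , Rw , Qval (Data.Nat.suc l) (length Rw))) ws res →
            Scan φ l R best c (w ∷ ws) res
  skip    : ∀ {best c w ws Rw res} → IsRw φ w R Rw →
            Qval (Data.Nat.suc l) (length Rw) ℤ.≤ best →
            Scan φ l R best c ws res →
            Scan φ l R best c (w ∷ ws) res

-- Grow φ L R Q L' R' Q' : the inner "repeat" loop started from (L, R, Q)
-- exits with (L', R', Q').  Each pass may use its own order ws.
data Grow (φ : Formula) : List ℕ → List Lit → ℤ → List ℕ → List Lit → ℤ → Set where
  exit : ∀ {L R Q ws} → IsOrder φ L ws →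
         Scan φ (length L) R Q nothing ws nothing →
         Grow φ L R Q L R Q
  add  : ∀ {L R Q ws w Rw Qw L' R' Q'} → IsOrder φ L ws →
         Scan φ (length L) R Q nothing ws (just (w , Rw , Qw)) →
         Grow φ (w ∷ L) Rw Qw L' R' Q' →
         Grow φ L R Q L' R' Q'

Select : Formula → List ℕ → List Lit → ℤ → Set
Select φ L R Q =
  ∃[ v ] ∃[ Rv ]
    ( IsVar φ v × IsN φ v Rv
    × (∀ u Ru → IsVar φ u → IsN φ u Ru → length Ru ≤ length Rv)
    × Grow φ [ v ] Rv (Qval 1 (length Rv)) L R Q)

data Run : Formula → Formula → Set where
  halt : ∀ {φ L R Q} → Select φ L R Q → Q ℤ.≤ + 0 → Run φ φ
  next : ∀ {φ L R Q y φ' ψ} → Select φ L R Q → + 0 ℤ.< Q →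
         BVAStep φ (map (λ v → [ neg v ]) L) (map (λ ℓ → [ ℓ ]) R) y φ' →
         Run φ' ψ → Run φ ψ

-- Throughout the run the formula is, as a set of clauses, the union of AtMostOne(M)
-- over pairwise disjoint "cliques" M of literals, each with at least 3 literals of
-- which at most one is positive, and the excess Σ (|M| - 2) stays equal to n - 2.
-- If v̄ lies in the clique M then N(v) = M ∖ {v̄}, so the selection starts in a largest
-- clique M.  A variable w whose negation lies outside M has R_w = ∅ and never becomes
-- the candidate; for the others Q_w > Q iff |L| < |R| - 1.  So the loop stops with
-- |R| ≤ |L| + 1, and the BVA step splits M into the cliques {y} ∪ L̄ and {ȳ} ∪ R,
-- preserving the excess.  The run stops when Q = (|L| - 1)(|R| - 1) - 1 ≤ 0, which
-- with |R| ≤ |L| + 1 forces |M| ≤ 4; as M is largest, every clique then has k ∈ {3, 4}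
-- literals and contributes (k choose 2) = 3(k - 2) clauses, 3(n - 2) in total.

module Submission where

open import Defs
open import Data.Nat using (ℕ; _≤_; _*_; _∸_)
open import Data.List using (length)
open import Relation.Binary.PropositionalEquality using (_≡_)
open import Function.Bundles using (_⇔_)

open import Data.Nat as ℕ using (zero; suc; _+_; _<_; s≤s; z≤n)
import Data.Nat.Properties as ℕP
open import Data.Nat.Combinatorics using (_C_; nC1≡n; nCk+nC[k+1]≡[n+1]C[k+1])
open import Data.Nat.ListAction using (sum)
open import Data.Nat.ListAction.Properties using (sum-↭)
open import Data.Nat.Tactic.RingSolver using (solve-∀)
open import Data.Integer as ℤ using (ℤ; +_; _⊖_)
import Data.Integer.Properties as ℤP
open import Data.Fin as Fin using (Fin)
import Data.Fin.Properties as FinP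
open import Data.Maybe using (just; nothing)
open import Data.Unit using (⊤; tt)
open import Data.Empty using (⊥; ⊥-elim)
open import Data.Product using (∃-syntax; _×_; _,_; proj₁; proj₂; uncurry)
open import Data.Sum using (_⊎_; inj₁; inj₂)
open import Data.List using (List; []; _∷_; _++_; [_]; map; lookup; concatMap; filter; applyUpTo)
import Data.List.Properties as ListP
open import Data.List.Relation.Unary.Any as Any using (Any; here; there)
import Data.List.Relation.Unary.Any.Properties as AnyP
open import Data.List.Relation.Unary.All as All using (All; []; _∷_)
import Data.List.Relation.Unary.All.Properties as AllP
open import Data.List.Relation.Unary.AllPairs as AllPairs using (AllPairs; []; _∷_)
open import Data.List.Relation.Unary.Unique.Propositional using (Unique)
import Data.List.Relation.Unary.Unique.Propositional.Properties as UniqueP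
open UniqueP using (Unique[x∷xs]⇒x∉xs)
import Data.List.Relation.Unary.Unique.Setoid.Properties as UniqueₛP
open import Data.List.Relation.Binary.Disjoint.Propositional using (Disjoint)
import Data.List.Relation.Binary.Disjoint.Propositional.Properties as DisjointP
import Data.List.Relation.Binary.Disjoint.Setoid as Disjointₛ
open import Data.List.Relation.Binary.Permutation.Propositional using (_↭_; ↭-sym; ↭⇒↭ₛ)
import Data.List.Relation.Binary.Permutation.Propositional.Properties as ↭P
import Data.List.Relation.Binary.Permutation.Setoid.Properties as ↭ₛP
open import Data.List.Membership.Propositional using (_∈_; _∉_; find; lose)
open import Data.List.Membership.Propositional.Properties
  using (∈-lookup; ∈-map⁺; ∈-map⁻; ∈-++⁻; ∈-filter⁺; ∈-filter⁻; ∈-∃++; ∈-applyUpTo⁺; ∈-applyUpTo⁻)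
import Data.List.Membership.Setoid as Membershipₛ
import Data.List.Membership.Setoid.Properties as MembershipₛP
open import Function.Base using (_∘_)
open import Function.Bundles using (mk⇔; Equivalence)
open import Function.Definitions using (Injective)
import Function.Properties.Equivalence as ⇔
open import Relation.Binary.Bundles using (Setoid)
open import Relation.Binary.Definitions using (DecidableEquality; tri<; tri≈; tri>)
open import Relation.Binary.PropositionalEquality hiding ([_])
open import Relation.Nullary using (¬_; ¬?; Dec; yes; no)
open import Relation.Nullary.Decidable using (map′)
open Equivalence

-- Q-values

⊖-cancelʳ-≤ : ∀ k {m n} → m ⊖ k ℤ.≤ n ⊖ k → m ≤ n
⊖-cancelʳ-≤ k h = ℕP.≮⇒≥ (λ n<m → ℤP.<⇒≱ (ℤP.⊖-monoˡ-< k n<m) h)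

⊖-≤⇔ : ∀ m n p q → m ⊖ n ℤ.≤ p ⊖ q ⇔ m + q ≤ p + n
⊖-≤⇔ m n p q = mk⇔
  (λ h → ⊖-cancelʳ-≤ (n + q) (subst₂ ℤ._≤_ (left m n q) (right p q n) h))
  (λ h → subst₂ ℤ._≤_ (sym (left m n q)) (sym (right p q n)) (ℤP.⊖-monoˡ-≤ (n + q) h))
  where
  left : ∀ m n q → m ⊖ n ≡ (m + q) ⊖ (n + q)
  left m n q = begin
    m ⊖ n             ≡⟨ sym (ℤP.+-cancelˡ-⊖ q m n) ⟩
    (q + m) ⊖ (q + n) ≡⟨ cong₂ _⊖_ (ℕP.+-comm q m) (ℕP.+-comm q n) ⟩
    (m + q) ⊖ (n + q) ∎
    where open ≡-Reasoning
  right : ∀ p q n → p ⊖ q ≡ (p + n) ⊖ (n + q)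
  right p q n = trans (left p q n) (cong ((p + n) ⊖_) (ℕP.+-comm q n))

Qval≡⊖ : ∀ l r → Qval l r ≡ (l * r) ⊖ (l + r)
Qval≡⊖ l r = begin
  + (l * r) ℤ.- + l ℤ.- + r          ≡⟨ ℤP.+-assoc (+ (l * r)) (ℤ.- + l) (ℤ.- + r) ⟩
  + (l * r) ℤ.+ (ℤ.- + l ℤ.- + r)    ≡⟨ cong (ℤ._+_ (+ (l * r))) (sym (ℤP.neg-distrib-+ (+ l) (+ r))) ⟩
  + (l * r) ℤ.- (+ l ℤ.+ + r)        ≡⟨ cong (λ t → + (l * r) ℤ.- t) (sym (ℤP.pos-+ l r)) ⟩
  + (l * r) ℤ.- + (l + r)            ≡⟨ ℤP.m-n≡m⊖n (l * r) (l + r) ⟩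
  (l * r) ⊖ (l + r)                  ∎
  where open ≡-Reasoning

Qval-≤⇔ : ∀ a b c d → Qval a b ℤ.≤ Qval c d ⇔ a * b + (c + d) ≤ c * d + (a + b)
Qval-≤⇔ a b c d rewrite Qval≡⊖ a b | Qval≡⊖ c d = ⊖-≤⇔ (a * b) (a + b) (c * d) (c + d)

Qval-exchange-≤⇔ : ∀ l r → Qval (suc l) r ℤ.≤ Qval l (suc r) ⇔ r ≤ l
Qval-exchange-≤⇔ l r = mk⇔
  (λ h → ℕP.+-cancelˡ-≤ k r l (subst₂ _≤_ (lhs l r) (rhs l r) (to (Qval-≤⇔ (suc l) r l (suc r)) h)))
  (λ h → from (Qval-≤⇔ (suc l) r l (suc r)) (subst₂ _≤_ (sym (lhs l r)) (sym (rhs l r)) (ℕP.+-monoʳ-≤ k h)))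
  where
  k : ℕ
  k = l * r + l + r + 1
  lhs : ∀ l r → suc l * r + (l + suc r) ≡ (l * r + l + r + 1) + r
  lhs = solve-∀
  rhs : ∀ l r → l * suc r + (suc l + r) ≡ (l * r + l + r + 1) + l
  rhs = solve-∀

Qval-exchange-< : ∀ l r → Qval l (suc r) ℤ.< Qval (suc l) r → l < r
Qval-exchange-< l r h = ℕP.≰⇒> (λ r≤l → ℤP.<⇒≱ h (from (Qval-exchange-≤⇔ l r) r≤l))

Qval-suc-zero-≤ : ∀ l r → 1 ≤ l → Qval (suc l) 0 ℤ.≤ Qval l r
Qval-suc-zero-≤ l r 1≤l = from (Qval-≤⇔ (suc l) 0 l r) (begin
  suc l * 0 + (l + r)   ≡⟨ cong (_+ (l + r)) (ℕP.*-zeroʳ (suc l)) ⟩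
  l + r                 ≤⟨ ℕP.+-mono-≤ (ℕP.≤-trans (ℕP.n≤1+n l) (ℕP.m≤m+n (suc l) 0))
                                       (ℕP.m≤n*m r l {{ℕ.>-nonZero 1≤l}}) ⟩
  (suc l + 0) + l * r   ≡⟨ ℕP.+-comm (suc l + 0) (l * r) ⟩
  l * r + (suc l + 0)   ∎)
  where open ℕP.≤-Reasoning

Qval-pos⇒2≤ : ∀ l r → + 0 ℤ.< Qval l r → 2 ≤ l
Qval-pos⇒2≤ (suc (suc l)) r _ = s≤s (s≤s z≤n)
Qval-pos⇒2≤ 0 r h = ⊥-elim (ℤP.<⇒≱ h (from (Qval-≤⇔ 0 r 0 0) z≤n))
Qval-pos⇒2≤ 1 r h =
  ⊥-elim (ℤP.<⇒≱ h (from (Qval-≤⇔ 1 r 0 0) (ℕP.≤-trans (ℕP.≤-reflexive (1*r+0≡r r)) (ℕP.n≤1+n r))))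
  where
  1*r+0≡r : ∀ r → 1 * r + 0 ≡ r
  1*r+0≡r = solve-∀

Qval-nonpos⇒≤4 : ∀ l r → 2 ≤ r → r ≤ suc l → Qval l r ℤ.≤ + 0 → l + r ≤ 4
Qval-nonpos⇒≤4 0 r 2≤r r≤1 _ = ⊥-elim (ℕP.1+n≰n (ℕP.≤-trans 2≤r r≤1))
Qval-nonpos⇒≤4 (suc (suc a)) 1 (s≤s ()) _ _
Qval-nonpos⇒≤4 1 r _ r≤2 _ = s≤s (ℕP.≤-trans r≤2 (ℕP.n≤1+n 2))
Qval-nonpos⇒≤4 l@(suc (suc a)) r@(suc (suc b)) _ _ h = begin
  l + r              ≡⟨ sum≡ a b ⟩
  4 + (a + b)        ≤⟨ ℕP.+-monoʳ-≤ 4 (ℕP.m+n≤o⇒m≤o (a + b) a+b+ab≤0) ⟩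
  4 + 0              ∎
  where
  open ℕP.≤-Reasoning
  sum≡ : ∀ a b → suc (suc a) + suc (suc b) ≡ 4 + (a + b)
  sum≡ = solve-∀
  product≡ : ∀ a b → suc (suc a) * suc (suc b) + 0 ≡ (suc (suc a) + suc (suc b)) + (a + b + a * b)
  product≡ = solve-∀
  a+b+ab≤0 : a + b + a * b ≤ 0
  a+b+ab≤0 = ℕP.+-cancelˡ-≤ (l + r) _ 0
    (subst₂ _≤_ (product≡ a b) (sym (ℕP.+-identityʳ (l + r))) (to (Qval-≤⇔ l r 0 0) h))

module _ {c ℓ} (S : Setoid c ℓ) where
  open Setoid S using (_≈_) renaming (sym to ≈-sym)
  open Membershipₛ S renaming (_∈_ to _∈ₛ_)
  open import Data.List.Relation.Unary.Unique.Setoid S renaming (Unique to Uniqueₛ)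

  Unique⇒lookup-injective : ∀ {xs} → Uniqueₛ xs → ∀ {i j} → lookup xs i ≈ lookup xs j → i ≡ j
  Unique⇒lookup-injective (_ ∷ _)    {Fin.zero}  {Fin.zero}  _  = refl
  Unique⇒lookup-injective (x≉xs ∷ _) {Fin.zero}  {Fin.suc j} eq = ⊥-elim (All.lookup x≉xs (∈-lookup j) eq)
  Unique⇒lookup-injective (x≉xs ∷ _) {Fin.suc i} {Fin.zero}  eq = ⊥-elim (All.lookup x≉xs (∈-lookup i) (≈-sym eq))
  Unique⇒lookup-injective (_ ∷ xs!)  {Fin.suc i} {Fin.suc j} eq = cong Fin.suc (Unique⇒lookup-injective xs! eq)

  Unique⇒⊆⇒length≤ : ∀ {xs ys} → Uniqueₛ xs → (∀ {x} → x ∈ₛ xs → x ∈ₛ ys) → length xs ≤ length ys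
  Unique⇒⊆⇒length≤ {xs} {ys} xs! xs⊆ys = FinP.injective⇒≤ position-injective
    where
    position : Fin (length xs) → Fin (length ys)
    position i = Any.index (xs⊆ys (MembershipₛP.∈-lookup S xs i))
    position-injective : Injective _≡_ _≡_ position
    position-injective {i} {j} eq = Unique⇒lookup-injective xs! (MembershipₛP.index-injective S
      (xs⊆ys (MembershipₛP.∈-lookup S xs i)) (xs⊆ys (MembershipₛP.∈-lookup S xs j)) eq)

  Unique⇒⊆⊇⇒length≡ : ∀ {xs ys} → Uniqueₛ xs → Uniqueₛ ys →
                      (∀ {x} → x ∈ₛ xs → x ∈ₛ ys) → (∀ {x} → x ∈ₛ ys → x ∈ₛ xs) →
                      length xs ≡ length ys
  Unique⇒⊆⊇⇒length≡ xs! ys! xs⊆ys ys⊆xs =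
    ℕP.≤-antisym (Unique⇒⊆⇒length≤ xs! xs⊆ys) (Unique⇒⊆⇒length≤ ys! ys⊆xs)

length-without : ∀ {A : Set} {x : A} {xs ys} → DecidableEquality A → Unique xs → x ∈ xs → Unique ys →
                 (∀ y → y ∈ ys ⇔ (y ∈ xs × y ≢ x)) → suc (length ys) ≡ length xs
length-without {x = x} {xs} {ys} _≟_ xs! x∈xs ys! ys≐ = Unique⇒⊆⊇⇒length≡ (setoid _)
  (All.tabulate (λ y∈ys x≡y → proj₂ (to (ys≐ _) y∈ys) (sym x≡y)) ∷ ys!) xs!
  (λ { (here refl) → x∈xs ; (there y∈ys) → proj₁ (to (ys≐ _) y∈ys) })
  (λ {y} → ∈x∷ys y)
  where
  ∈x∷ys : ∀ y → y ∈ xs → y ∈ x ∷ ys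
  ∈x∷ys y y∈xs with y ≟ x
  ... | yes refl = here refl
  ... | no y≢x   = there (from (ys≐ y) (y∈xs , y≢x))

neg-injective : ∀ {u v} → neg u ≡ neg v → u ≡ v
neg-injective refl = refl

pos-injective : ∀ {u v} → pos u ≡ pos v → u ≡ v
pos-injective refl = refl

_≟ᴸ_ : DecidableEquality Lit
pos u ≟ᴸ pos v = map′ (cong pos) pos-injective (u ℕP.≟ v)
pos _ ≟ᴸ neg _ = no λ ()
neg _ ≟ᴸ pos _ = no λ ()
neg u ≟ᴸ neg v = map′ (cong neg) neg-injective (u ℕP.≟ v)

≋-setoid : Setoid _ _
≋-setoid = record
  { _≈_ = _≋_
  ; isEquivalence = record
    { refl  = λ _ → ⇔.refl
    ; sym   = λ C≋D ℓ → ⇔.sym (C≋D ℓ)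
    ; trans = λ C≋D D≋E ℓ → ⇔.trans (C≋D ℓ) (D≋E ℓ)
    }
  }

open Setoid ≋-setoid using () renaming (refl to ≋-refl; trans to ≋-trans)

∈-⟨∨⟩⁻ : ∀ {x a b} → x ∈ ⟨ a ∨ b ⟩ → x ≡ a ⊎ x ≡ b
∈-⟨∨⟩⁻ (here x≡a)         = inj₁ x≡a
∈-⟨∨⟩⁻ (there (here x≡b)) = inj₂ x≡b

∨-comm : ∀ {a b} → ⟨ a ∨ b ⟩ ≋ ⟨ b ∨ a ⟩
∨-comm ℓ = mk⇔ swap swap
  where
  swap : ∀ {a b} → ℓ ∈ ⟨ a ∨ b ⟩ → ℓ ∈ ⟨ b ∨ a ⟩
  swap (here ℓ≡a)         = there (here ℓ≡a)
  swap (there (here ℓ≡b)) = here ℓ≡b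

_∈AMO_ : Clause → List Lit → Set
E ∈AMO A = ∃[ a ] ∃[ b ] (a ∈ A × b ∈ A × a ≢ b × E ≋ ⟨ a ∨ b ⟩)

∈AMO-lits : ∀ {E A x} → E ∈AMO A → x ∈ E → x ∈ A
∈AMO-lits {x = x} (a , b , a∈A , b∈A , _ , E≋ab) x∈E with ∈-⟨∨⟩⁻ (to (E≋ab x) x∈E)
... | inj₁ refl = a∈A
... | inj₂ refl = b∈A

∈AMO-mono : ∀ {E A B} → (∀ {x} → x ∈ A → x ∈ B) → E ∈AMO A → E ∈AMO B
∈AMO-mono A⊆B (a , b , a∈A , b∈A , a≢b , E≋ab) = a , b , A⊆B a∈A , A⊆B b∈A , a≢b , E≋ab

∈AMO-resp-≋ : ∀ {E F A} → E ≋ F → F ∈AMO A → E ∈AMO A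
∈AMO-resp-≋ E≋F (a , b , a∈A , b∈A , a≢b , F≋ab) = a , b , a∈A , b∈A , a≢b , ≋-trans E≋F F≋ab

⟨∨⟩∈AMO⁻ : ∀ {a b A} → ⟨ a ∨ b ⟩ ∈AMO A → a ∈ A × b ∈ A × a ≢ b
⟨∨⟩∈AMO⁻ {a} {b} E∈AMO@(c , d , _ , _ , c≢d , ab≋cd) =
  ∈AMO-lits E∈AMO (here refl) , ∈AMO-lits E∈AMO (there (here refl)) , a≢b
  where
  a≢b : a ≢ b
  a≢b refl with ∈-⟨∨⟩⁻ (from (ab≋cd c) (here refl)) | ∈-⟨∨⟩⁻ (from (ab≋cd d) (there (here refl)))
  ... | inj₁ refl | inj₁ refl = c≢d refl
  ... | inj₁ refl | inj₂ refl = c≢d refl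
  ... | inj₂ refl | inj₁ refl = c≢d refl
  ... | inj₂ refl | inj₂ refl = c≢d refl

∈AMO-∷⁻ : ∀ {E x A} → E ∈AMO (x ∷ A) → E ∈AMO A ⊎ ∃[ a ] (a ∈ A × E ≋ ⟨ a ∨ x ⟩)
∈AMO-∷⁻ (a , b , here refl , here refl , a≢b , _)  = ⊥-elim (a≢b refl)
∈AMO-∷⁻ (a , b , here refl , there b∈A , _ , E≋ab) = inj₂ (b , b∈A , ≋-trans E≋ab ∨-comm)
∈AMO-∷⁻ (a , b , there a∈A , here refl , _ , E≋ab) = inj₂ (a , a∈A , E≋ab)
∈AMO-∷⁻ (a , b , there a∈A , there b∈A , a≢b , E≋ab) = inj₁ (a , b , a∈A , b∈A , a≢b , E≋ab)

∈AMO-split : ∀ {E M A B} → (∀ {x} → x ∈ M → x ∈ A ⊎ x ∈ B) → E ∈AMO M →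
             E ∈AMO A ⊎ E ∈AMO B ⊎ ∃[ a ] ∃[ b ] (a ∈ A × b ∈ B × E ≋ ⟨ a ∨ b ⟩)
∈AMO-split M⊆A∪B (a , b , a∈M , b∈M , a≢b , E≋ab) with M⊆A∪B a∈M | M⊆A∪B b∈M
... | inj₁ a∈A | inj₁ b∈A = inj₁ (a , b , a∈A , b∈A , a≢b , E≋ab)
... | inj₂ a∈B | inj₂ b∈B = inj₂ (inj₁ (a , b , a∈B , b∈B , a≢b , E≋ab))
... | inj₁ a∈A | inj₂ b∈B = inj₂ (inj₂ (a , b , a∈A , b∈B , E≋ab))
... | inj₂ a∈B | inj₁ b∈A = inj₂ (inj₂ (b , a , b∈A , a∈B , ≋-trans E≋ab ∨-comm))

∨-injectiveʳ : ∀ {a b c} → ⟨ a ∨ b ⟩ ≋ ⟨ a ∨ c ⟩ → b ≡ c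
∨-injectiveʳ {a} {b} {c} ab≋ac
  with ∈-⟨∨⟩⁻ (to (ab≋ac b) (there (here refl))) | ∈-⟨∨⟩⁻ (from (ab≋ac c) (there (here refl)))
... | inj₂ b≡c | _        = b≡c
... | inj₁ b≡a | inj₁ c≡a = trans b≡a (sym c≡a)
... | inj₁ _   | inj₂ c≡b = sym c≡b

atMostOne : List Lit → Formula
atMostOne []      = []
atMostOne (a ∷ A) = map (λ b → ⟨ a ∨ b ⟩) A ++ atMostOne A

length-atMostOne : ∀ A → length (atMostOne A) ≡ length A C 2
length-atMostOne []      = refl
length-atMostOne (a ∷ A) = begin
  length (map (λ b → ⟨ a ∨ b ⟩) A ++ atMostOne A)
    ≡⟨ ListP.length-++ (map (λ b → ⟨ a ∨ b ⟩) A) ⟩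
  length (map (λ b → ⟨ a ∨ b ⟩) A) + length (atMostOne A)
    ≡⟨ cong₂ _+_ (ListP.length-map _ A) (length-atMostOne A) ⟩
  length A + length A C 2
    ≡⟨ cong (_+ length A C 2) (sym (nC1≡n (length A))) ⟩
  length A C 1 + length A C 2
    ≡⟨ nCk+nC[k+1]≡[n+1]C[k+1] (length A) 1 ⟩
  suc (length A) C 2
    ∎
  where open ≡-Reasoning

⟨∨⟩∈atMostOne : ∀ {a b A} → a ∈ A → b ∈ A → a ≢ b → ⟨ a ∨ b ⟩ ∈F atMostOne A
⟨∨⟩∈atMostOne (here refl) (here refl) a≢b = ⊥-elim (a≢b refl)
⟨∨⟩∈atMostOne (here refl) (there b∈A) _ = AnyP.++⁺ˡ (AnyP.map⁺ (Any.map (λ { refl → ≋-refl }) b∈A))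
⟨∨⟩∈atMostOne (there a∈A) (here refl) _ = AnyP.++⁺ˡ (AnyP.map⁺ (Any.map (λ { refl → ∨-comm }) a∈A))
⟨∨⟩∈atMostOne {A = x ∷ A} (there a∈A) (there b∈A) a≢b =
  AnyP.++⁺ʳ (map (λ b → ⟨ x ∨ b ⟩) A) (⟨∨⟩∈atMostOne a∈A b∈A a≢b)

∈AMO⇒∈atMostOne : ∀ {E A} → E ∈AMO A → E ∈F atMostOne A
∈AMO⇒∈atMostOne (a , b , a∈A , b∈A , a≢b , E≋ab) = Any.map (≋-trans E≋ab) (⟨∨⟩∈atMostOne a∈A b∈A a≢b)

∈atMostOne⇒∈AMO : ∀ {E A} → Unique A → E ∈ atMostOne A → E ∈AMO A
∈atMostOne⇒∈AMO {A = a ∷ A} (a∉A ∷ A!) E∈ with ∈-++⁻ (map (λ b → ⟨ a ∨ b ⟩) A) E∈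
... | inj₂ E∈rest = ∈AMO-mono there (∈atMostOne⇒∈AMO A! E∈rest)
... | inj₁ E∈row with ∈-map⁻ (λ b → ⟨ a ∨ b ⟩) E∈row
...   | b , b∈A , refl = a , b , here refl , there b∈A , All.lookup a∉A b∈A , ≋-refl

∈F-atMostOne⇒∈AMO : ∀ {E A} → Unique A → E ∈F atMostOne A → E ∈AMO A
∈F-atMostOne⇒∈AMO A! E∈F with find E∈F
... | F , F∈ , E≋F = ∈AMO-resp-≋ E≋F (∈atMostOne⇒∈AMO A! F∈)

atMostOne-distinct : ∀ {A} → Unique A → Distinct (atMostOne A)
atMostOne-distinct {[]}    _          = []
atMostOne-distinct {a ∷ A} aA!@(_ ∷ A!) = UniqueₛP.++⁺ ≋-setoid
  (UniqueₛP.map⁺ (setoid Lit) ≋-setoid ∨-injectiveʳ A!)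
  (atMostOne-distinct A!)
  (λ (E∈row , E∈rest) → Unique[x∷xs]⇒x∉xs aA! (∈AMO-lits (∈F-atMostOne⇒∈AMO A! E∈rest) (a∈E E∈row)))
  where
  a∈E : ∀ {E} → E ∈F map (λ b → ⟨ a ∨ b ⟩) A → a ∈ E
  a∈E E∈row with find E∈row
  ... | F , F∈ , E≋F with ∈-map⁻ (λ b → ⟨ a ∨ b ⟩) F∈
  ...   | b , _ , refl = from (E≋F a) (here refl)

-- Clique covers

Positive : Lit → Set
Positive (pos _) = ⊤
Positive (neg _) = ⊥

AtMostOnePositive : List Lit → Set
AtMostOnePositive A = ∀ {a b} → a ∈ A → b ∈ A → Positive a → Positive b → a ≡ b

negative∈ : ∀ {A} → Unique A → AtMostOnePositive A → 2 ≤ length A → ∃[ u ] (neg u ∈ A)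
negative∈ {neg u ∷ _}         _  _ _ = u , here refl
negative∈ {pos _ ∷ neg u ∷ _} _  _ _ = u , there (here refl)
negative∈ {pos _ ∷ []}        _  _ (s≤s ())
negative∈ {pos _ ∷ pos _ ∷ _} A! ≤1pos _ =
  ⊥-elim (Unique[x∷xs]⇒x∉xs A! (here (≤1pos (here refl) (there (here refl)) tt tt)))

record IsClique (M : List Lit) : Set where
  field
    unique        : Unique M
    size≥3        : 3 ≤ length M
    ≤1-positive   : AtMostOnePositive M

record CliqueCover (n : ℕ) (φ : Formula) (Ms : List (List Lit)) : Set where
  field
    distinct : Distinct φ
    clauses  : ∀ E → E ∈F φ ⇔ Any (E ∈AMO_) Ms
    cliques  : All IsClique Ms
    disjoint : AllPairs Disjoint Ms
    excess   : sum (map (λ M → length M ∸ 2) Ms) ≡ n ∸ 2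

another∈ : ∀ {X : Set} {A : List X} {x} → Unique A → 2 ≤ length A → x ∈ A → ∃[ b ] (b ∈ A × b ≢ x)
another∈ {A = _ ∷ []}    _  (s≤s ()) _
another∈ {A = a ∷ b ∷ _} A! _ (here refl) =
  b , there (here refl) , λ b≡a → Unique[x∷xs]⇒x∉xs A! (here (sym b≡a))
another∈ {A = a ∷ _}     A! _ (there x∈A) = a , here refl , λ { refl → Unique[x∷xs]⇒x∉xs A! x∈A }

AllPairs-Disjoint⇒≡ : ∀ {Ms M₁ M₂} {x : Lit} → AllPairs Disjoint Ms →
                      M₁ ∈ Ms → M₂ ∈ Ms → x ∈ M₁ → x ∈ M₂ → M₁ ≡ M₂
AllPairs-Disjoint⇒≡ _          (here refl)  (here refl)  _    _    = refl
AllPairs-Disjoint⇒≡ (M#Ms ∷ _) (here refl)  (there M₂∈) x∈M₁ x∈M₂ =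
  ⊥-elim (All.lookup M#Ms M₂∈ (x∈M₁ , x∈M₂))
AllPairs-Disjoint⇒≡ (M#Ms ∷ _) (there M₁∈) (here refl)  x∈M₁ x∈M₂ =
  ⊥-elim (All.lookup M#Ms M₁∈ (x∈M₂ , x∈M₁))
AllPairs-Disjoint⇒≡ (_ ∷ Ms#)  (there M₁∈) (there M₂∈) x∈M₁ x∈M₂ =
  AllPairs-Disjoint⇒≡ Ms# M₁∈ M₂∈ x∈M₁ x∈M₂

module CoverProperties {n φ Ms} (cover : CliqueCover n φ Ms) where
  open CliqueCover cover

  clique : ∀ {M} → M ∈ Ms → IsClique M
  clique = All.lookup cliques

  ⟨∨⟩∈F⇒ : ∀ {a b} → ⟨ a ∨ b ⟩ ∈F φ → ∃[ M ] (M ∈ Ms × a ∈ M × b ∈ M × a ≢ b)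
  ⟨∨⟩∈F⇒ ab∈φ with find (to (clauses _) ab∈φ)
  ... | M , M∈Ms , ab∈AMO = M , M∈Ms , ⟨∨⟩∈AMO⁻ ab∈AMO

  neighbour⇔ : ∀ {M x} → M ∈ Ms → x ∈ M → ∀ ℓ → ⟨ x ∨ ℓ ⟩ ∈F φ ⇔ (ℓ ∈ M × ℓ ≢ x)
  neighbour⇔ {M} {x} M∈Ms x∈M ℓ = mk⇔ from-φ to-φ
    where
    from-φ : ⟨ x ∨ ℓ ⟩ ∈F φ → ℓ ∈ M × ℓ ≢ x
    from-φ xℓ∈φ with ⟨∨⟩∈F⇒ xℓ∈φ
    ... | M' , M'∈Ms , x∈M' , ℓ∈M' , x≢ℓ =
      subst (ℓ ∈_) (AllPairs-Disjoint⇒≡ disjoint M'∈Ms M∈Ms x∈M' x∈M) ℓ∈M' , x≢ℓ ∘ sym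
    to-φ : ℓ ∈ M × ℓ ≢ x → ⟨ x ∨ ℓ ⟩ ∈F φ
    to-φ (ℓ∈M , ℓ≢x) = from (clauses _) (lose M∈Ms (_ , ℓ , x∈M , ℓ∈M , ℓ≢x ∘ sym , ≋-refl))

  clique-size≥2 : ∀ {M} → M ∈ Ms → 2 ≤ length M
  clique-size≥2 M∈Ms = ℕP.≤-trans (ℕP.n≤1+n 2) (IsClique.size≥3 (clique M∈Ms))

  clique-negative : ∀ {M} → M ∈ Ms → ∃[ u ] (neg u ∈ M)
  clique-negative M∈Ms =
    negative∈ (IsClique.unique (clique M∈Ms)) (IsClique.≤1-positive (clique M∈Ms)) (clique-size≥2 M∈Ms)

  occurs : ∀ {M x} → M ∈ Ms → x ∈ M → ∃[ C ] (C ∈ φ × x ∈ C)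
  occurs {x = x} M∈Ms x∈M with another∈ (IsClique.unique (clique M∈Ms)) (clique-size≥2 M∈Ms) x∈M
  ... | b , b∈M , b≢x with find (from (neighbour⇔ M∈Ms x∈M b) (b∈M , b≢x))
  ...   | C , C∈φ , xb≋C = C , C∈φ , to (xb≋C x) (here refl)

  fresh⇒∉ : ∀ {y M} → ¬ IsVar φ y → M ∈ Ms → pos y ∉ M × neg y ∉ M
  fresh⇒∉ y∉φ M∈Ms =
    (λ y∈M → let (C , C∈φ , y∈C) = occurs M∈Ms y∈M in y∉φ (C , C∈φ , inj₁ y∈C)) ,
    (λ y∈M → let (C , C∈φ , y∈C) = occurs M∈Ms y∈M in y∉φ (C , C∈φ , inj₂ y∈C))

  neg∈⇒IsVar : ∀ {u M} → M ∈ Ms → neg u ∈ M → IsVar φ u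
  neg∈⇒IsVar M∈Ms u∈M = let (C , C∈φ , u∈C) = occurs M∈Ms u∈M in C , C∈φ , inj₂ u∈C

  IsVar⇒clique : ∀ {v} → IsVar φ v → ∃[ M ] (M ∈ Ms)
  IsVar⇒clique (C , C∈φ , _) with find (to (clauses C) (lose C∈φ ≋-refl))
  ... | M , M∈Ms , _ = M , M∈Ms

  N-length : ∀ {M v R} → M ∈ Ms → neg v ∈ M → IsN φ v R → suc (length R) ≡ length M
  N-length M∈Ms v∈M (R! , R≐) =
    length-without _≟ᴸ_ (IsClique.unique (clique M∈Ms)) v∈M R!
      (λ ℓ → ⇔.trans (R≐ ℓ) (neighbour⇔ M∈Ms v∈M ℓ))

  N-exists : ∀ {M u} → M ∈ Ms → neg u ∈ M → ∃[ R ] IsN φ u R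
  N-exists {M} {u} M∈Ms u∈M =
    filter ≢u? M , UniqueP.filter⁺ ≢u? (IsClique.unique (clique M∈Ms)) ,
    λ ℓ → ⇔.trans (mk⇔ (∈-filter⁻ ≢u?) (uncurry (∈-filter⁺ ≢u?))) (⇔.sym (neighbour⇔ M∈Ms u∈M ℓ))
    where
    ≢u? : ∀ ℓ → Dec (ℓ ≢ neg u)
    ≢u? ℓ = ¬? (ℓ ≟ᴸ neg u)

-- The selection phase

record Split (M : List Lit) (L : List ℕ) (R : List Lit) : Set where
  field
    L-unique : Unique L
    negL⊆M   : ∀ {v} → v ∈ L → neg v ∈ M
    R-unique : Unique R
    R≐M∖negL : ∀ ℓ → ℓ ∈ R ⇔ (ℓ ∈ M × ℓ ∉ map neg L)
    length≡  : length L + length R ≡ length M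
    L≥1      : 1 ≤ length L
    R≥2      : 2 ≤ length R

neg∈map-neg⁻ : ∀ {w L} → neg w ∈ map neg L → w ∈ L
neg∈map-neg⁻ w∈ with ∈-map⁻ neg w∈
... | _ , v∈L , refl = v∈L

scan-nothing : ∀ {φ l R best c ws} → Scan φ l R best c ws nothing →
               c ≡ nothing × (∀ {w} → w ∈ ws → ∃[ Rw ] (IsRw φ w R Rw × Qval (suc l) (length Rw) ℤ.≤ best))
scan-nothing done = refl , λ ()
scan-nothing (improve _ _ scan) with scan-nothing scan
... | () , _
scan-nothing (skip {Rw = Rw} Rw-spec Qw≤best scan) with scan-nothing scan
... | refl , later = refl , λ { (here refl) → Rw , Rw-spec , Qw≤best ; (there w∈ws) → later w∈ws }

scan-just : ∀ {φ l R best c ws w Rw q} → Scan φ l R best c ws (just (w , Rw , q)) →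
            c ≡ just (w , Rw , q) ⊎ (w ∈ ws × IsRw φ w R Rw × q ≡ Qval (suc l) (length Rw) × best ℤ.< q)
scan-just done = inj₁ refl
scan-just (improve Rw-spec best<Qw scan) with scan-just scan
... | inj₁ refl = inj₂ (here refl , Rw-spec , refl , best<Qw)
... | inj₂ (w∈ws , spec , q≡ , Qw<q) = inj₂ (there w∈ws , spec , q≡ , ℤP.<-trans best<Qw Qw<q)
scan-just (skip _ _ scan) with scan-just scan
... | inj₁ c≡ = inj₁ c≡
... | inj₂ (w∈ws , spec , q≡ , best<q) = inj₂ (there w∈ws , spec , q≡ , best<q)

module SplitProperties {n φ Ms} (cover : CliqueCover n φ Ms) {M} (M∈Ms : M ∈ Ms) where
  open CliqueCover cover
  open CoverProperties cover

  module _ {L R} (split : Split M L R) where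
    open Split split

    R⊆M : ∀ {ℓ} → ℓ ∈ R → ℓ ∈ M
    R⊆M ℓ∈R = proj₁ (to (R≐M∖negL _) ℓ∈R)

    neg∈R : ∃[ w ] (neg w ∈ R)
    neg∈R = negative∈ R-unique
      (λ a∈R b∈R → IsClique.≤1-positive (clique M∈Ms) (R⊆M a∈R) (R⊆M b∈R)) R≥2

    Rw≐R∖w : ∀ {w Rw} → neg w ∈ M → IsRw φ w R Rw → ∀ ℓ → ℓ ∈ Rw ⇔ (ℓ ∈ R × ℓ ≢ neg w)
    Rw≐R∖w w∈M (_ , Rw≐) ℓ = ⇔.trans (Rw≐ ℓ) (mk⇔
      (λ (ℓ∈R , wℓ∈φ) → ℓ∈R , proj₂ (to (neighbour⇔ M∈Ms w∈M ℓ) wℓ∈φ))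
      (λ (ℓ∈R , ℓ≢w) → ℓ∈R , from (neighbour⇔ M∈Ms w∈M ℓ) (R⊆M ℓ∈R , ℓ≢w)))

    Rw-length : ∀ {w Rw} → w ∉ L → neg w ∈ M → IsRw φ w R Rw → suc (length Rw) ≡ length R
    Rw-length w∉L w∈M Rw-spec = length-without _≟ᴸ_ R-unique
      (from (R≐M∖negL _) (w∈M , w∉L ∘ neg∈map-neg⁻)) (proj₁ Rw-spec) (Rw≐R∖w w∈M Rw-spec)

    -- A variable whose negation lies outside M shares no neighbour with R ⊆ M,
    -- so its Q-value is Qval (|L| + 1) 0, which never beats Qval |L| |R|.
    gain⇒neg∈M : ∀ {w Rw} → IsRw φ w R Rw →
                 Qval (length L) (length R) ℤ.< Qval (suc (length L)) (length Rw) → neg w ∈ M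
    gain⇒neg∈M {Rw = []} _ Q<Qw = ⊥-elim (ℤP.<⇒≱ Q<Qw (Qval-suc-zero-≤ (length L) (length R) L≥1))
    gain⇒neg∈M {w} {ℓ ∷ _} (_ , Rw≐) _ with to (Rw≐ ℓ) (here refl)
    ... | ℓ∈R , wℓ∈φ with ⟨∨⟩∈F⇒ wℓ∈φ
    ...   | M' , M'∈Ms , w∈M' , ℓ∈M' , _ =
      subst (neg w ∈_) (AllPairs-Disjoint⇒≡ disjoint M'∈Ms M∈Ms ℓ∈M' (R⊆M ℓ∈R)) w∈M'

    split-extend : ∀ {w Rw} → w ∉ L → neg w ∈ M → IsRw φ w R Rw → length L < length Rw → Split M (w ∷ L) Rw
    split-extend {w} {Rw} w∉L w∈M Rw-spec L<Rw = record
      { L-unique = All.tabulate (λ { v∈L refl → w∉L v∈L }) ∷ L-unique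
      ; negL⊆M   = λ { (here refl) → w∈M ; (there v∈L) → negL⊆M v∈L }
      ; R-unique = proj₁ Rw-spec
      ; R≐M∖negL = λ ℓ → mk⇔ (to-M ℓ) (from-M ℓ)
      ; length≡  = trans (sym (ℕP.+-suc (length L) (length Rw)))
                         (trans (cong (λ r → length L + r) (Rw-length w∉L w∈M Rw-spec)) length≡)
      ; L≥1      = s≤s z≤n
      ; R≥2      = ℕP.≤-trans (s≤s L≥1) L<Rw
      }
      where
      to-M : ∀ ℓ → ℓ ∈ Rw → ℓ ∈ M × ℓ ∉ map neg (w ∷ L)
      to-M ℓ ℓ∈Rw with to (Rw≐R∖w w∈M Rw-spec ℓ) ℓ∈Rw
      ... | ℓ∈R , ℓ≢w with to (R≐M∖negL ℓ) ℓ∈R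
      ...   | ℓ∈M , ℓ∉negL = ℓ∈M , λ { (here ℓ≡w) → ℓ≢w ℓ≡w ; (there ℓ∈negL) → ℓ∉negL ℓ∈negL }
      from-M : ∀ ℓ → ℓ ∈ M × ℓ ∉ map neg (w ∷ L) → ℓ ∈ Rw
      from-M ℓ (ℓ∈M , ℓ∉) =
        from (Rw≐R∖w w∈M Rw-spec ℓ) (from (R≐M∖negL ℓ) (ℓ∈M , ℓ∉ ∘ there) , ℓ∉ ∘ here)

    exit-balanced : ∀ {ws} → IsOrder φ L ws → Scan φ (length L) R (Qval (length L) (length R)) nothing ws nothing →
                    length R ≤ suc (length L)
    exit-balanced order scan with neg∈R
    ... | w , w∈R with to (R≐M∖negL _) w∈R
    ...   | w∈M , w∉negL
      with proj₂ (scan-nothing scan) (from (proj₂ order w) (neg∈⇒IsVar M∈Ms w∈M , w∉negL ∘ ∈-map⁺ neg))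
    ...     | Rw , Rw-spec , Qw≤Q = subst (_≤ suc (length L)) |R|≡
                (s≤s (to (Qval-exchange-≤⇔ (length L) (length Rw))
                  (subst (λ r → Qval (suc (length L)) (length Rw) ℤ.≤ Qval (length L) r) (sym |R|≡) Qw≤Q)))
      where
      |R|≡ : suc (length Rw) ≡ length R
      |R|≡ = Rw-length (w∉negL ∘ ∈-map⁺ neg) w∈M Rw-spec

    extend : ∀ {ws w Rw Qw} → IsOrder φ L ws →
             Scan φ (length L) R (Qval (length L) (length R)) nothing ws (just (w , Rw , Qw)) →
             Split M (w ∷ L) Rw × Qw ≡ Qval (suc (length L)) (length Rw)
    extend {w = w} {Rw} order scan with scan-just scan
    ... | inj₁ ()
    ... | inj₂ (w∈ws , Rw-spec , Qw≡ , Q<Qw) = split-extend w∉L w∈M Rw-spec L<Rw , Qw≡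
      where
      w∉L : w ∉ L
      w∉L = proj₂ (to (proj₂ order w) w∈ws)
      w∈M : neg w ∈ M
      w∈M = gain⇒neg∈M Rw-spec (subst (_ ℤ.<_) Qw≡ Q<Qw)
      L<Rw : length L < length Rw
      L<Rw = Qval-exchange-< (length L) (length Rw) (subst₂ (λ r q → Qval (length L) r ℤ.< q)
               (sym (Rw-length w∉L w∈M Rw-spec)) Qw≡ Q<Qw)

  grow : ∀ {L R Q L' R' Q'} → Split M L R → Q ≡ Qval (length L) (length R) → Grow φ L R Q L' R' Q' →
         Split M L' R' × Q' ≡ Qval (length L') (length R') × length R' ≤ suc (length L')
  grow split refl (exit order scan)      = split , refl , exit-balanced split order scan
  grow split refl (add order scan loop) with extend split order scan
  ... | split' , Qw≡ = grow split' Qw≡ loop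

MaximalN : Formula → List Lit → Set
MaximalN φ Rv = ∀ u Ru → IsVar φ u → IsN φ u Ru → length Ru ≤ length Rv

record Selected (Ms : List (List Lit)) (L : List ℕ) (R : List Lit) (Q : ℤ) : Set where
  field
    {M}      : List Lit
    M∈Ms     : M ∈ Ms
    split    : Split M L R
    Q≡       : Q ≡ Qval (length L) (length R)
    balanced : length R ≤ suc (length L)
    largest  : All (λ M' → length M' ≤ length M) Ms

module _ {n φ Ms} (cover : CliqueCover n φ Ms) where
  open CoverProperties cover

  split-initial : ∀ {M v Rv} → M ∈ Ms → neg v ∈ M → IsN φ v Rv → 2 ≤ length Rv → Split M [ v ] Rv
  split-initial M∈Ms v∈M (Rv! , Rv≐) Rv≥2 = record
    { L-unique = [] ∷ []
    ; negL⊆M   = λ { (here refl) → v∈M }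
    ; R-unique = Rv!
    ; R≐M∖negL = λ ℓ → ⇔.trans (⇔.trans (Rv≐ ℓ) (neighbour⇔ M∈Ms v∈M ℓ))
                         (mk⇔ (λ (ℓ∈M , ℓ≢v) → ℓ∈M , λ { (here ℓ≡v) → ℓ≢v ℓ≡v })
                              (λ (ℓ∈M , ℓ∉) → ℓ∈M , ℓ∉ ∘ here))
    ; length≡  = N-length M∈Ms v∈M (Rv! , Rv≐)
    ; L≥1      = s≤s z≤n
    ; R≥2      = Rv≥2
    }

  maximal⇒clique-≤ : ∀ (Rv : List Lit) → MaximalN φ Rv → ∀ {M'} → M' ∈ Ms → length M' ≤ suc (length Rv)
  maximal⇒clique-≤ Rv Rv-max M'∈Ms with clique-negative M'∈Ms
  ... | u , u∈M' with N-exists M'∈Ms u∈M'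
  ...   | Ru , Ru-spec = subst (_≤ suc (length Rv)) (N-length M'∈Ms u∈M' Ru-spec)
                           (s≤s (Rv-max u Ru (neg∈⇒IsVar M'∈Ms u∈M') Ru-spec))

  maximal⇒2≤ : ∀ {v} (Rv : List Lit) → IsVar φ v → MaximalN φ Rv → 2 ≤ length Rv
  maximal⇒2≤ Rv v∈φ Rv-max with IsVar⇒clique v∈φ
  ... | M₀ , M₀∈Ms =
    ℕP.≤-pred (ℕP.≤-trans (IsClique.size≥3 (clique M₀∈Ms)) (maximal⇒clique-≤ Rv Rv-max M₀∈Ms))

  N-nonempty⇒clique : ∀ {v Rv} → IsN φ v Rv → 1 ≤ length Rv → ∃[ M ] (M ∈ Ms × neg v ∈ M)
  N-nonempty⇒clique {Rv = ℓ ∷ _} (_ , Rv≐) _ with ⟨∨⟩∈F⇒ (to (Rv≐ ℓ) (here refl))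
  ... | M , M∈Ms , v∈M , _ = M , M∈Ms , v∈M

  select : ∀ {L R Q} → Select φ L R Q → Selected Ms L R Q
  select (v , Rv , v∈φ , Rv-spec , Rv-max , loop) =
    let Rv≥2                    = maximal⇒2≤ Rv v∈φ Rv-max
        (_ , M∈Ms , v∈M)        = N-nonempty⇒clique Rv-spec (ℕP.≤-trans (s≤s z≤n) Rv≥2)
        (split , Q≡ , balanced) = SplitProperties.grow cover M∈Ms (split-initial M∈Ms v∈M Rv-spec Rv≥2) refl loop
    in record
      { M∈Ms     = M∈Ms
      ; split    = split
      ; Q≡       = Q≡
      ; balanced = balanced
      ; largest  = All.tabulate λ M'∈Ms →
                     subst (_ ≤_) (N-length M∈Ms v∈M Rv-spec) (maximal⇒clique-≤ Rv Rv-max M'∈Ms)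
      }

-- The BVA step

CliqueCover-resp-↭ : ∀ {n φ Ms Ms'} → Ms ↭ Ms' → CliqueCover n φ Ms → CliqueCover n φ Ms'
CliqueCover-resp-↭ Ms↭Ms' cover = record
  { distinct = distinct
  ; clauses  = λ E → ⇔.trans (clauses E) (mk⇔ (↭P.Any-resp-↭ Ms↭Ms') (↭P.Any-resp-↭ (↭-sym Ms↭Ms')))
  ; cliques  = ↭P.All-resp-↭ Ms↭Ms' cliques
  ; disjoint = ↭ₛP.AllPairs-resp-↭ (setoid _) DisjointP.sym (resp₂ Disjoint) (↭⇒↭ₛ Ms↭Ms') disjoint
  ; excess   = trans (sym (sum-↭ (↭P.map⁺ _ Ms↭Ms'))) excess
  }
  where open CliqueCover cover

focus : ∀ {n φ Ms M} → CliqueCover n φ Ms → M ∈ Ms → ∃[ Rest ] CliqueCover n φ (M ∷ Rest)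
focus cover M∈Ms with ∈-∃++ M∈Ms
... | ys , zs , refl = ys ++ zs , CliqueCover-resp-↭ (↭P.shift _ ys zs) cover

Disjoint-⊆∷ : ∀ {A B D : List Lit} {z} → (∀ {x} → x ∈ A → x ∈ z ∷ D) → z ∉ B → Disjoint D B → Disjoint A B
Disjoint-⊆∷ A⊆zD z∉B D#B (x∈A , x∈B) with A⊆zD x∈A
... | here refl = z∉B x∈B
... | there x∈D = D#B (x∈D , x∈B)

excess-split : ∀ l r → 1 ≤ l → 1 ≤ r → (suc l ∸ 2) + (suc r ∸ 2) ≡ (l + r) ∸ 2
excess-split (suc a) (suc b) _ _ = cong (_∸ 1) (sym (ℕP.+-suc a b))

module BVAStepProperties {n φ M Ms L R y φ'} (cover : CliqueCover n φ (M ∷ Ms)) (split : Split M L R)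
         (L≥2 : 2 ≤ length L) (step : BVAStep φ (map (λ v → [ neg v ]) L) (map (λ ℓ → [ ℓ ]) R) y φ') where
  open CliqueCover cover
  open CoverProperties cover
  open Split split hiding (negL⊆M)
  open BVAStep step

  ML MR : List Lit
  ML = pos y ∷ map neg L
  MR = neg y ∷ R

  negL⊆M : ∀ {x} → x ∈ map neg L → x ∈ M
  negL⊆M x∈ with ∈-map⁻ neg x∈
  ... | _ , v∈L , refl = Split.negL⊆M split v∈L

  R⊆M : ∀ {ℓ} → ℓ ∈ R → ℓ ∈ M
  R⊆M = SplitProperties.R⊆M cover (here refl) split

  negL#R : Disjoint (map neg L) R
  negL#R (x∈negL , x∈R) = proj₂ (to (R≐M∖negL _) x∈R) x∈negL

  M⊆negL∪R : ∀ {x} → x ∈ M → x ∈ map neg L ⊎ x ∈ R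
  M⊆negL∪R {x} x∈M with Any.any? (x ≟ᴸ_) (map neg L)
  ... | yes x∈negL = inj₁ x∈negL
  ... | no x∉negL  = inj₂ (from (R≐M∖negL x) (x∈M , x∉negL))

  M#Ms : All (Disjoint M) Ms
  M#Ms = AllPairs.head disjoint

  y∉M : pos y ∉ M × neg y ∉ M
  y∉M = fresh⇒∉ fresh (here refl)

  Replaced : Clause → Set
  Replaced = IsReplaced (map (λ v → [ neg v ]) L) (map (λ ℓ → [ ℓ ]) R)

  cross⇒replaced : ∀ {E a b} → a ∈ map neg L → b ∈ R → E ≋ ⟨ a ∨ b ⟩ → Replaced E
  cross⇒replaced a∈negL b∈R E≋ab with ∈-map⁻ neg a∈negL
  ... | v , v∈L , refl = [ neg v ] , [ _ ] , ∈-map⁺ _ v∈L , ∈-map⁺ _ b∈R , E≋ab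

  unreplaced : ∀ {E} → (∀ {a b} → a ∈ map neg L → b ∈ R → a ∈ E → b ∈ E → ⊥) → ¬ Replaced E
  unreplaced no-cross (C , D , C∈ , D∈ , E≋CD) with ∈-map⁻ _ C∈ | ∈-map⁻ _ D∈
  ... | v , v∈L , refl | ℓ , ℓ∈R , refl =
    no-cross (∈-map⁺ neg v∈L) ℓ∈R (from (E≋CD _) (here refl)) (from (E≋CD _) (there (here refl)))

  kept : ∀ {E} → E ∈F φ → ¬ Replaced E → E ∈F φ'
  kept E∈φ E-unreplaced = from (result _) (inj₁ (E∈φ , E-unreplaced))

  to-cliques : ∀ {E} → E ∈F φ' → Any (E ∈AMO_) (ML ∷ MR ∷ Ms)
  to-cliques {E} E∈φ' with to (result E) E∈φ'
  ... | inj₂ (inj₁ (C , C∈ , E≋)) with ∈-map⁻ _ C∈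
  ...   | v , v∈L , refl = here (neg v , pos y , there (∈-map⁺ neg v∈L) , here refl , (λ ()) , E≋)
  to-cliques {E} E∈φ' | inj₂ (inj₂ (D , D∈ , E≋)) with ∈-map⁻ _ D∈
  ...   | ℓ , ℓ∈R , refl =
    there (here (neg y , ℓ , here refl , there ℓ∈R , (λ { refl → proj₂ y∉M (R⊆M ℓ∈R) }) , E≋))
  to-cliques {E} E∈φ' | inj₁ (E∈φ , E-unreplaced) with to (clauses E) E∈φ
  ...   | there E∈Ms = there (there E∈Ms)
  ...   | here E∈AMO-M with ∈AMO-split M⊆negL∪R E∈AMO-M
  ...     | inj₁ E∈negL                          = here (∈AMO-mono there E∈negL)
  ...     | inj₂ (inj₁ E∈R)                      = there (here (∈AMO-mono there E∈R))
  ...     | inj₂ (inj₂ (_ , _ , a∈ , b∈ , E≋ab)) = ⊥-elim (E-unreplaced (cross⇒replaced a∈ b∈ E≋ab))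

  from-cliques : ∀ {E} → Any (E ∈AMO_) (ML ∷ MR ∷ Ms) → E ∈F φ'
  from-cliques {E} (here E∈ML) with ∈AMO-∷⁻ E∈ML
  ... | inj₁ E∈negL = kept (from (clauses E) (here (∈AMO-mono negL⊆M E∈negL)))
                           (unreplaced λ _ b∈R _ b∈E → negL#R (∈AMO-lits E∈negL b∈E , b∈R))
  ... | inj₂ (a , a∈negL , E≋) with ∈-map⁻ neg a∈negL
  ...   | v , v∈L , refl = from (result E) (inj₂ (inj₁ ([ neg v ] , ∈-map⁺ _ v∈L , E≋)))
  from-cliques {E} (there (here E∈MR)) with ∈AMO-∷⁻ E∈MR
  ... | inj₁ E∈R = kept (from (clauses E) (here (∈AMO-mono R⊆M E∈R)))
                        (unreplaced λ a∈negL _ a∈E _ → negL#R (a∈negL , ∈AMO-lits E∈R a∈E))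
  ... | inj₂ (ℓ , ℓ∈R , E≋) = from (result E) (inj₂ (inj₂ ([ ℓ ] , ∈-map⁺ _ ℓ∈R , ≋-trans E≋ ∨-comm)))
  from-cliques {E} (there (there E∈Ms)) with find E∈Ms
  ... | M' , M'∈Ms , E∈AMO-M' = kept (from (clauses E) (there E∈Ms))
    (unreplaced λ a∈negL _ a∈E _ → All.lookup M#Ms M'∈Ms (negL⊆M a∈negL , ∈AMO-lits E∈AMO-M' a∈E))

  ML-clique : IsClique ML
  ML-clique = record
    { unique      = AllP.¬Any⇒All¬ _ pos∉negL ∷ UniqueP.map⁺ neg-injective L-unique
    ; size≥3      = s≤s (subst (2 ≤_) (sym (ListP.length-map neg L)) L≥2)
    ; ≤1-positive = λ a∈ b∈ a+ b+ → trans (positive≡y a∈ a+) (sym (positive≡y b∈ b+))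
    }
    where
    pos∉negL : pos y ∉ map neg L
    pos∉negL y∈ with ∈-map⁻ neg y∈
    ... | _ , _ , ()
    positive≡y : ∀ {a} → a ∈ ML → Positive a → a ≡ pos y
    positive≡y (here refl) _ = refl
    positive≡y (there a∈negL) a+ with ∈-map⁻ neg a∈negL
    positive≡y (there a∈negL) () | _ , _ , refl

  MR-clique : IsClique MR
  MR-clique = record
    { unique      = AllP.¬Any⇒All¬ _ (proj₂ y∉M ∘ R⊆M) ∷ R-unique
    ; size≥3      = s≤s R≥2
    ; ≤1-positive = λ a∈ b∈ a+ b+ →
                      IsClique.≤1-positive (clique (here refl)) (positive∈M a∈ a+) (positive∈M b∈ b+) a+ b+
    }
    where
    positive∈M : ∀ {a} → a ∈ MR → Positive a → a ∈ M
    positive∈M (here refl) ()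
    positive∈M (there a∈R) _ = R⊆M a∈R

  ML#MR : Disjoint ML MR
  ML#MR (here refl , here ())
  ML#MR (here refl , there y∈R)        = proj₁ y∉M (R⊆M y∈R)
  ML#MR (there x∈negL , here refl)     = proj₂ y∉M (negL⊆M x∈negL)
  ML#MR (there x∈negL , there x∈R)     = negL#R (x∈negL , x∈R)

  ML⊆y∷M : ∀ {x} → x ∈ ML → x ∈ pos y ∷ M
  ML⊆y∷M (here refl)    = here refl
  ML⊆y∷M (there x∈negL) = there (negL⊆M x∈negL)

  MR⊆y∷M : ∀ {x} → x ∈ MR → x ∈ neg y ∷ M
  MR⊆y∷M (here refl) = here refl
  MR⊆y∷M (there x∈R) = there (R⊆M x∈R)

  excess-after-step : sum (map (λ M → length M ∸ 2) (ML ∷ MR ∷ Ms)) ≡ n ∸ 2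
  excess-after-step = begin
    (suc (length (map neg L)) ∸ 2) + ((suc (length R) ∸ 2) + S)
      ≡⟨ cong (λ l → (suc l ∸ 2) + ((suc (length R) ∸ 2) + S)) (ListP.length-map neg L) ⟩
    (suc (length L) ∸ 2) + ((suc (length R) ∸ 2) + S)
      ≡⟨ sym (ℕP.+-assoc (suc (length L) ∸ 2) _ S) ⟩
    (suc (length L) ∸ 2) + (suc (length R) ∸ 2) + S
      ≡⟨ cong (_+ S) (excess-split _ _ L≥1 (ℕP.≤-trans (ℕP.n≤1+n 1) R≥2)) ⟩
    (length L + length R) ∸ 2 + S
      ≡⟨ cong (λ m → m ∸ 2 + S) length≡ ⟩
    length M ∸ 2 + S
      ≡⟨ excess ⟩
    n ∸ 2
      ∎
    where
    open ≡-Reasoning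
    S : ℕ
    S = sum (map (λ M → length M ∸ 2) Ms)

  cover-after-step : CliqueCover n φ' (ML ∷ MR ∷ Ms)
  cover-after-step = record
    { distinct = BVAStep.distinct step
    ; clauses  = λ E → mk⇔ to-cliques from-cliques
    ; cliques  = ML-clique ∷ MR-clique ∷ All.tail cliques
    ; disjoint = (ML#MR ∷ All.tabulate λ M'∈Ms →
                    Disjoint-⊆∷ ML⊆y∷M (proj₁ (fresh⇒∉ fresh (there M'∈Ms))) (All.lookup M#Ms M'∈Ms))
               ∷ All.tabulate (λ M'∈Ms →
                    Disjoint-⊆∷ MR⊆y∷M (proj₂ (fresh⇒∉ fresh (there M'∈Ms))) (All.lookup M#Ms M'∈Ms))
               ∷ AllPairs.tail disjoint
    ; excess   = excess-after-step
    }

negatives : ℕ → List Lit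
negatives n = applyUpTo (λ i → neg (suc i)) n

negatives-clique : ∀ {n} → 3 ≤ n → IsClique (negatives n)
negatives-clique {n} 3≤n = record
  { unique      = UniqueP.applyUpTo⁺₁ _ n (λ i<j _ → ℕP.<⇒≢ i<j ∘ ℕP.suc-injective ∘ neg-injective)
  ; size≥3      = subst (3 ≤_) (sym (ListP.length-applyUpTo _ n)) 3≤n
  ; ≤1-positive = λ a∈ _ a+ _ → ⊥-elim (negative a∈ a+)
  }
  where
  negative : ∀ {a} → a ∈ negatives n → Positive a → ⊥
  negative a∈ with ∈-applyUpTo⁻ _ a∈
  ... | _ , _ , refl = λ ()

AMOClause⇔∈AMO : ∀ {n} C → IsAMOClause n C ⇔ C ∈AMO negatives n
AMOClause⇔∈AMO {n} C = mk⇔ to-AMO from-AMO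
  where
  to-AMO : IsAMOClause n C → C ∈AMO negatives n
  to-AMO (suc i , suc j , _ , s≤s i<j , j<n , C≋) =
    neg (suc i) , neg (suc j) , ∈-applyUpTo⁺ _ (ℕP.<-trans i<j j<n) , ∈-applyUpTo⁺ _ j<n ,
    ℕP.<⇒≢ i<j ∘ ℕP.suc-injective ∘ neg-injective , C≋
  from-AMO : C ∈AMO negatives n → IsAMOClause n C
  from-AMO (a , b , a∈ , b∈ , a≢b , C≋) with ∈-applyUpTo⁻ _ a∈ | ∈-applyUpTo⁻ _ b∈
  ... | i , i<n , refl | j , j<n , refl with ℕP.<-cmp i j
  ...   | tri< i<j _ _ = suc i , suc j , s≤s z≤n , s≤s i<j , j<n , C≋
  ...   | tri≈ _ refl _ = ⊥-elim (a≢b refl)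
  ...   | tri> _ _ j<i = suc j , suc i , s≤s z≤n , s≤s j<i , i<n , ≋-trans C≋ ∨-comm

initial-cover : ∀ {n φ₀} → 3 ≤ n → Distinct φ₀ → (∀ C → C ∈F φ₀ ⇔ IsAMOClause n C) →
                CliqueCover n φ₀ [ negatives n ]
initial-cover {n} 3≤n φ₀-distinct φ₀≐AMO = record
  { distinct = φ₀-distinct
  ; clauses  = λ C → ⇔.trans (⇔.trans (φ₀≐AMO C) (AMOClause⇔∈AMO C)) (mk⇔ here AnyP.singleton⁻)
  ; cliques  = negatives-clique 3≤n ∷ []
  ; disjoint = [] ∷ []
  ; excess   = trans (ℕP.+-identityʳ _) (cong (_∸ 2) (ListP.length-applyUpTo _ n))
  }

∈F-concatMap-atMostOne⁻ : ∀ {E Ms} → All IsClique Ms → E ∈F concatMap atMostOne Ms → Any (E ∈AMO_) Ms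
∈F-concatMap-atMostOne⁻ {Ms = Ms} cliques E∈ with find (AnyP.map⁻ (AnyP.concat⁻ (map atMostOne Ms) E∈))
... | M , M∈Ms , E∈M = lose M∈Ms (∈F-atMostOne⇒∈AMO (IsClique.unique (All.lookup cliques M∈Ms)) E∈M)

concatMap-atMostOne-distinct : ∀ {Ms} → All IsClique Ms → AllPairs Disjoint Ms → Distinct (concatMap atMostOne Ms)
concatMap-atMostOne-distinct []       []            = []
concatMap-atMostOne-distinct (c ∷ cs) (M#Ms ∷ Ms#) = UniqueₛP.++⁺ ≋-setoid
  (atMostOne-distinct (IsClique.unique c)) (concatMap-atMostOne-distinct cs Ms#) no-common-clause
  where
  no-common-clause : Disjointₛ.Disjoint ≋-setoid _ _
  no-common-clause (E∈M , E∈Ms)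
    with ∈F-atMostOne⇒∈AMO (IsClique.unique c) E∈M | find (∈F-concatMap-atMostOne⁻ cs E∈Ms)
  ... | a , _ , a∈M , _ , _ , E≋ab | _ , M'∈Ms , E∈AMO-M' =
    All.lookup M#Ms M'∈Ms (a∈M , ∈AMO-lits E∈AMO-M' (from (E≋ab a) (here refl)))

C2-small : ∀ k → 3 ≤ k → k ≤ 4 → k C 2 ≡ 3 * (k ∸ 2)
C2-small 3 _ _ = refl
C2-small 4 _ _ = refl
C2-small (suc (suc (suc (suc (suc _))))) _ (s≤s (s≤s (s≤s (s≤s ()))))
C2-small (suc (suc zero)) (s≤s (s≤s ())) _
C2-small (suc zero) (s≤s ()) _
C2-small zero () _

length-concatMap-atMostOne : ∀ {Ms} → All IsClique Ms → All (λ M → length M ≤ 4) Ms →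
                             length (concatMap atMostOne Ms) ≡ 3 * sum (map (λ M → length M ∸ 2) Ms)
length-concatMap-atMostOne []       []       = refl
length-concatMap-atMostOne {M ∷ Ms} (c ∷ cs) (M≤4 ∷ Ms≤4) = begin
  length (atMostOne M ++ concatMap atMostOne Ms)
    ≡⟨ ListP.length-++ (atMostOne M) ⟩
  length (atMostOne M) + length (concatMap atMostOne Ms)
    ≡⟨ cong₂ _+_ (trans (length-atMostOne M) (C2-small _ (IsClique.size≥3 c) M≤4))
                 (length-concatMap-atMostOne cs Ms≤4) ⟩
  3 * (length M ∸ 2) + 3 * sum (map (λ M → length M ∸ 2) Ms)
    ≡⟨ sym (ℕP.*-distribˡ-+ 3 (length M ∸ 2) _) ⟩
  3 * sum (map (λ M → length M ∸ 2) (M ∷ Ms))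
    ∎
  where open ≡-Reasoning

cover-length : ∀ {n ψ Ms} → CliqueCover n ψ Ms → All (λ M → length M ≤ 4) Ms → length ψ ≡ 3 * (n ∸ 2)
cover-length {n} {ψ} {Ms} cover Ms≤4 = begin
  length ψ
    ≡⟨ Unique⇒⊆⊇⇒length≡ ≋-setoid distinct (concatMap-atMostOne-distinct cliques disjoint) ψ⊆ ⊆ψ ⟩
  length (concatMap atMostOne Ms)
    ≡⟨ length-concatMap-atMostOne cliques Ms≤4 ⟩
  3 * sum (map (λ M → length M ∸ 2) Ms)
    ≡⟨ cong (3 *_) excess ⟩
  3 * (n ∸ 2)
    ∎
  where
  open ≡-Reasoning
  open CliqueCover cover
  ψ⊆ : ∀ {E} → E ∈F ψ → E ∈F concatMap atMostOne Ms
  ψ⊆ {E} E∈ψ = AnyP.concat⁺ (AnyP.map⁺ (Any.map ∈AMO⇒∈atMostOne (to (clauses E) E∈ψ)))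
  ⊆ψ : ∀ {E} → E ∈F concatMap atMostOne Ms → E ∈F ψ
  ⊆ψ {E} E∈ = from (clauses E) (∈F-concatMap-atMostOne⁻ cliques E∈)

run-cover : ∀ {n φ ψ Ms} → CliqueCover n φ Ms → Run φ ψ →
            ∃[ Ms' ] (CliqueCover n ψ Ms' × All (λ M → length M ≤ 4) Ms')
run-cover cover (halt {L = L} {R = R} sel Q≤0) =
  _ , cover , All.map (λ M'≤M → ℕP.≤-trans M'≤M M≤4) largest
  where
  open Selected (select cover sel)
  M≤4 : length M ≤ 4
  M≤4 = subst (_≤ 4) (Split.length≡ split)
          (Qval-nonpos⇒≤4 (length L) (length R) (Split.R≥2 split) balanced (subst (ℤ._≤ + 0) Q≡ Q≤0))
run-cover cover (next {L = L} {R = R} sel 0<Q step rest) =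
  run-cover (BVAStepProperties.cover-after-step (proj₂ (focus cover M∈Ms)) split L≥2 step) rest
  where
  open Selected (select cover sel)
  L≥2 : 2 ≤ length L
  L≥2 = Qval-pos⇒2≤ (length L) (length R) (subst (+ 0 ℤ.<_) Q≡ 0<Q)

theorem46 : (n : ℕ) → 3 ≤ n →
            (φ₀ : Formula) → Distinct φ₀ → (∀ C → (C ∈F φ₀) ⇔ IsAMOClause n C) →
            (ψ : Formula) → Run φ₀ ψ → length ψ ≡ 3 * n ∸ 6
theorem46 n 3≤n φ₀ φ₀-distinct φ₀≐AMO ψ run =
  let (_ , cover , small) = run-cover (initial-cover 3≤n φ₀-distinct φ₀≐AMO) run
  in trans (cover-length cover small) (ℕP.*-distribˡ-∸ 3 n 2)
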